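{- Let $\pi\in S_n$ have LTR-max decomposition $\pi=M_1P_1\cdots M_{k-1}P_{k-1}M_k$, and suppose that for some index $i$ with $2\le i\le k-1$ the factor $M_i$ consists of a single entry $\mu_i$. Let $\rho\in S_n$ have LTR-max decomposition $\rho=N_1R_1\cdots N_{i-1}R'_iN_{i+1}R_{i+1}\cdots N_{k-1}R_{k-1}N_k$, where $|N_j|=|M_j|$ and $|R_j|=|P_j|$ for all indices $j\neq i$ occurring, $|R'_i|=|P_{i-1}M_iP_i|$, and $R'_i$ contains no LTR maximum of $\rho$ (equivalently, the set of positions of LTR maxima of $\rho$ is that of $\pi$ with the position of $\mu_i$ removed). Then $|q^{ -1}(\rho)|=|q^{ -1}(\pi)|$.
   Context: $S_n$ is the set of permutations of $\{1,\dots,n\}$ in one-line notation. An entry $\pi_i$ is a left-to-right (LTR) maximum if $\pi_i>\pi_j$ for all $j<i$. The map $q:S_n\to S_n$ (the algorithm Queuesort, sorting with a queue allowing bypass): let $m_1,\dots,m_r$ be the LTR maxima of $\pi$ from left to right; for $i=r,\dots,1$ in this order, repeatedly swap $m_i$ with the entry immediately to its right as long as such an entry exists and is smaller than $m_i$; the result is $q(\pi)$. $q^{ -1}(\pi)=\{\sigma\in S_n: q(\sigma)=\pi\}$. The LTR-max decomposition of $\pi$ is the factorization $\pi=M_1P_1M_2P_2\cdots M_{k-1}P_{k-1}M_k$ into consecutive factors, where the $M_j$ are the maximal factors consisting of consecutive LTR maxima and the $P_j$ are the nonempty factors between them consisting of non-LTR-maxima; $M_1,\dots,M_{k-1}$ are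 nonempty and $M_k$ may be empty. -}

module Defs where

open import Data.Nat using (ℕ; zero; suc; _<_; _<ᵇ_; _≡ᵇ_)
open import Data.Bool using (Bool; true; false; if_then_else_; _∧_; T)
open import Data.List using (List; []; _∷_; length; foldr; map; upTo)
open import Data.Bool.ListAction using (all; any)
open import Data.Product using (Σ; _×_)
open import Relation.Binary.PropositionalEquality using (_≡_)

-- Permutations of {1,…,n} in one-line notation, represented as lists of
-- naturals.  σ ∈ S_n  iff  length σ = n and every k ∈ {1,…,n} occurs in σ.
-- (Boolean test so that the membership proof is proof-irrelevant.)
isPermᵇ : ℕ → List ℕ → Bool
isPermᵇ n σ = (length σ ≡ᵇ n) ∧ all (λ k → any (λ x → k ≡ᵇ x) σ) (map suc (upTo n))

IsPerm : ℕ → List ℕ → Set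
IsPerm n σ = T (isPermᵇ n σ)

-- Entry at 0-based position i (default 0 out of range; entries are ≥ 1).
at : List ℕ → ℕ → ℕ
at []       _       = 0
at (x ∷ xs) zero    = x
at (x ∷ xs) (suc i) = at xs i

IsLTRMax : List ℕ → ℕ → Set
IsLTRMax σ i = (i < length σ) × (∀ j → j < i → at σ j < at σ i)

-- Values of the LTR maxima, from left to right (values are ≥ 1).
ltrAux : ℕ → List ℕ → List ℕ
ltrAux cur []       = []
ltrAux cur (x ∷ xs) = if cur <ᵇ x then x ∷ ltrAux x xs else ltrAux cur xs

ltrMaxima : List ℕ → List ℕ
ltrMaxima = ltrAux 0

push : ℕ → List ℕ → List ℕ
push m []       = m ∷ []
push m (y ∷ ys) = if y <ᵇ m then y ∷ push m ys else m ∷ y ∷ ys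

sink : ℕ → List ℕ → List ℕ
sink m []       = []
sink m (x ∷ xs) = if x ≡ᵇ m then push m xs else x ∷ sink m xs

-- Queuesort: process LTR maxima m_r, …, m_1 (last one first).
-- foldr sink π [m₁,…,m_r] = sink m₁ (… (sink m_r π)).
q : List ℕ → List ℕ
q π = foldr sink π (ltrMaxima π)

Preimage : ℕ → List ℕ → Set
Preimage n π = Σ (List ℕ) (λ σ → IsPerm n σ × q σ ≡ π)

module Submission where

-- Let f be the relabelling of values with f ∘ π = ρ position by position. Then
-- σ ↦ f ∘ σ maps q⁻¹(π) onto q⁻¹(ρ), with inverse the relabelling in the other
-- direction. Queuesort only compares entries with the left-to-right maxima
-- before them, and passing from π to ρ destroys only the maximum μᵢ, which
-- follows a non-maximum and is followed by a smaller entry. Tracking this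
-- through the recursion
--   queuesortFrom c (y ∷ ys) = push y (queuesortFrom y ys)   if c < y,
--                            = y ∷ queuesortFrom c ys          otherwise,
-- shows q (f ∘ σ) = f ∘ q σ whenever q σ = π. In the other direction the
-- maximum created at μᵢ's position is harmless because the entry of ρ there is
-- dominated by an earlier maximum of ρ.

open import Axiom.UniquenessOfIdentityProofs using (module Decidable⇒UIP)
open import Data.Bool using (true; false; T; if_then_else_)
open import Data.Bool.ListAction using (any)
open import Data.Bool.Properties using (T-≡; T-∧; T-irrelevant)
open import Data.Fin using (Fin; toℕ; fromℕ<; punchOut)
open import Data.Fin.Properties
  using (toℕ<n; toℕ-fromℕ<; toℕ-injective; punchOut-injective; injective⇒≤; any?)
  renaming (_≟_ to _≟ᶠ_)
open import Data.List using (List; []; _∷_; length; foldr; map; upTo)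
open import Data.List.Membership.Propositional using (_∈_)
open import Data.List.Membership.Propositional.Properties using (∈-map⁺; ∈-map⁻; ∈-upTo⁺; ∈-upTo⁻)
open import Data.List.Properties using (length-map; map-∘; map-id-local; ≡-dec)
open import Data.List.Relation.Unary.All as All using (All; []; _∷_)
open import Data.List.Relation.Unary.All.Properties using (all⁺; all⁻)
open import Data.List.Relation.Unary.Any using (Any; here; there)
open import Data.List.Relation.Unary.Any.Properties using (any⁺; any⁻)
open import Data.Nat using (ℕ; zero; suc; _<_; _≤_; _<ᵇ_; _≡ᵇ_; z≤n; s≤s; z<s; s≤s⁻¹; s<s⁻¹; _<?_)
open import Data.Nat.Properties
open import Data.Product using (∃; _×_; _,_; proj₁; proj₂)
open import Data.Sum using (inj₁; inj₂)
open import Function using (_∘_; case_of_)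
open import Function.Bundles using (Equivalence; _↔_; _⇔_; mk↔ₛ′)
open import Function.Definitions using (Injective)
open import Relation.Binary using (tri<; tri≈; tri>)
open import Relation.Binary.PropositionalEquality
open import Relation.Nullary using (¬_; Dec; yes; no; contradiction)
open import Relation.Nullary.Decidable using (_×-dec_; map′; decidable-stable)

open import Defs

T⇒≡true : ∀ {b} → T b → b ≡ true
T⇒≡true = Equivalence.to T-≡

¬T⇒≡false : ∀ {b} → ¬ T b → b ≡ false
¬T⇒≡false {false} _  = refl
¬T⇒≡false {true}  ¬t = contradiction _ ¬t

<ᵇ-true : ∀ {m n} → m < n → (m <ᵇ n) ≡ true
<ᵇ-true = T⇒≡true ∘ <⇒<ᵇ

<ᵇ-false : ∀ {m n} → ¬ m < n → (m <ᵇ n) ≡ false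
<ᵇ-false {m} {n} m≮n = ¬T⇒≡false (m≮n ∘ <ᵇ⇒< m n)

≡ᵇ-false : ∀ {m n} → m ≢ n → (m ≡ᵇ n) ≡ false
≡ᵇ-false {m} {n} m≢n = ¬T⇒≡false (m≢n ∘ ≡ᵇ⇒≡ m n)

≡ᵇ-refl : ∀ m → (m ≡ᵇ m) ≡ true
≡ᵇ-refl m = T⇒≡true (≡⇒≡ᵇ m m refl)

-- Queuesort of a suffix whose prefix has maximum c: only entries exceeding c and
-- everything before them are pushed. By definition q = queuesortFrom 0.
queuesortFrom : ℕ → List ℕ → List ℕ
queuesortFrom c ys = foldr sink ys (ltrAux c ys)

ltrAux-above : ∀ c ys → All (c <_) (ltrAux c ys)
ltrAux-above c []       = []
ltrAux-above c (x ∷ xs) with c <? x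
... | yes c<x rewrite <ᵇ-true c<x = c<x ∷ All.map (<-trans c<x) (ltrAux-above x xs)
... | no  c≮x rewrite <ᵇ-false c≮x = ltrAux-above c xs

foldr-sink-∷ : ∀ y ys {ms} → All (y <_) ms → foldr sink (y ∷ ys) ms ≡ y ∷ foldr sink ys ms
foldr-sink-∷ y ys []                   = refl
foldr-sink-∷ y ys (y<m ∷ y<ms) rewrite foldr-sink-∷ y ys y<ms | ≡ᵇ-false (<⇒≢ y<m) = refl

queuesortFrom-< : ∀ {c y} ys → c < y → queuesortFrom c (y ∷ ys) ≡ push y (queuesortFrom y ys)
queuesortFrom-< {c} {y} ys c<y
  rewrite <ᵇ-true c<y | foldr-sink-∷ y ys (ltrAux-above y ys) | ≡ᵇ-refl y = refl

queuesortFrom-≮ : ∀ {c y} ys → ¬ c < y → queuesortFrom c (y ∷ ys) ≡ y ∷ queuesortFrom c ys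
queuesortFrom-≮ {c} {y} ys c≮y rewrite <ᵇ-false c≮y =
  foldr-sink-∷ y ys (All.map (≤-<-trans (≮⇒≥ c≮y)) (ltrAux-above c ys))

insertAt : ℕ → ℕ → List ℕ → List ℕ
insertAt zero    y xs       = y ∷ xs
insertAt (suc k) y []       = y ∷ []
insertAt (suc k) y (x ∷ xs) = x ∷ insertAt k y xs

map-insertAt : ∀ (f : ℕ → ℕ) k y xs → map f (insertAt k y xs) ≡ insertAt k (f y) (map f xs)
map-insertAt f zero    y xs       = refl
map-insertAt f (suc k) y []       = refl
map-insertAt f (suc k) y (x ∷ xs) = cong (f x ∷_) (map-insertAt f k y xs)

length-insertAt : ∀ {k} y xs → k ≤ length xs → length (insertAt k y xs) ≡ suc (length xs)
length-insertAt {zero}  y xs       _         = refl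
length-insertAt {suc k} y (x ∷ xs) (s≤s k≤n) = cong suc (length-insertAt y xs k≤n)

at-insertAt-≡ : ∀ {k} y xs → k ≤ length xs → at (insertAt k y xs) k ≡ y
at-insertAt-≡ {zero}  y xs       _         = refl
at-insertAt-≡ {suc k} y (x ∷ xs) (s≤s k≤n) = at-insertAt-≡ y xs k≤n

at-insertAt-< : ∀ {k i} y xs → k ≤ length xs → i < k → at (insertAt k y xs) i ≡ at xs i
at-insertAt-< {suc k} {zero}  y (x ∷ xs) _         _         = refl
at-insertAt-< {suc k} {suc i} y (x ∷ xs) (s≤s k≤n) (s≤s i<k) = at-insertAt-< y xs k≤n i<k

at-insertAt-≥ : ∀ {k i} y xs → k ≤ i → at (insertAt k y xs) (suc i) ≡ at xs i
at-insertAt-≥ {zero}          y xs       _         = refl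
at-insertAt-≥ {suc k} {suc i} y []       _         = refl
at-insertAt-≥ {suc k} {suc i} y (x ∷ xs) (s≤s k≤i) = at-insertAt-≥ y xs k≤i

at-map : ∀ (f : ℕ → ℕ) xs {i} → i < length xs → at (map f xs) i ≡ f (at xs i)
at-map f (x ∷ xs) {zero}  _         = refl
at-map f (x ∷ xs) {suc i} (s≤s i<n) = at-map f xs i<n

record StopsAt (y : ℕ) (xs : List ℕ) (k : ℕ) : Set where
  field
    k≤length : k ≤ length xs
    before   : ∀ {i} → i < k → at xs i < y
    blocked  : k < length xs → ¬ at xs k < y

push-stopsAt : ∀ {y xs k} → StopsAt y xs k → push y xs ≡ insertAt k y xs
push-stopsAt {y} {[]}     {zero} _ = refl
push-stopsAt {y} {x ∷ xs} {zero} s rewrite <ᵇ-false (StopsAt.blocked s z<s) = refl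
push-stopsAt {y} {x ∷ xs} {suc k} s rewrite <ᵇ-true (StopsAt.before s z<s) =
  cong (x ∷_) (push-stopsAt record
    { k≤length = s≤s⁻¹ (StopsAt.k≤length s)
    ; before   = StopsAt.before s ∘ s≤s
    ; blocked  = StopsAt.blocked s ∘ s≤s })

stopsAt : ∀ y xs → ∃ (StopsAt y xs)
stopsAt y [] = zero , record { k≤length = z≤n ; before = λ () ; blocked = λ () }
stopsAt y (x ∷ xs) with x <? y
... | no  x≮y = zero , record { k≤length = z≤n ; before = λ () ; blocked = λ _ → x≮y }
... | yes x<y with stopsAt y xs
...   | k , s = suc k , record
  { k≤length = s≤s (StopsAt.k≤length s)
  ; before   = λ { {zero} _ → x<y ; {suc i} (s≤s i<k) → StopsAt.before s i<k }
  ; blocked  = StopsAt.blocked s ∘ s<s⁻¹ }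

-- Left-to-right maxima above a threshold

IsLTRMaxAbove : ℕ → List ℕ → ℕ → Set
IsLTRMaxAbove c xs j = j < length xs × c < at xs j × (∀ i → i < j → at xs i < at xs j)

isLTRMaxAbove? : ∀ c xs j → Dec (IsLTRMaxAbove c xs j)
isLTRMaxAbove? c xs j =
  j <? length xs ×-dec c <? at xs j ×-dec
  map′ (λ h i i<j → h i<j) (λ h {i} → h i) (allUpTo? (λ i → at xs i <? at xs j) j)

isLTRMaxAbove-head⁺ : ∀ {c y xs} → c < y → IsLTRMaxAbove c (y ∷ xs) 0
isLTRMaxAbove-head⁺ c<y = z<s , c<y , λ _ ()

isLTRMaxAbove-head⁻ : ∀ {c y xs} → IsLTRMaxAbove c (y ∷ xs) 0 → c < y
isLTRMaxAbove-head⁻ (_ , c<y , _) = c<y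

isLTRMaxAbove-tail⁺ : ∀ {c y xs j} → ¬ c < y → IsLTRMaxAbove c xs j → IsLTRMaxAbove c (y ∷ xs) (suc j)
isLTRMaxAbove-tail⁺ {c} {y} {xs} {j} c≮y (j<n , c<xⱼ , max) = s≤s j<n , c<xⱼ , max′
  where
  max′ : ∀ i → i < suc j → at (y ∷ xs) i < at xs j
  max′ zero    _         = ≤-<-trans (≮⇒≥ c≮y) c<xⱼ
  max′ (suc i) (s≤s i<j) = max i i<j

isLTRMaxAbove-tail⁻ : ∀ {c y xs j} → IsLTRMaxAbove c (y ∷ xs) (suc j) → IsLTRMaxAbove c xs j
isLTRMaxAbove-tail⁻ (s≤s j<n , c<xⱼ , max) = j<n , c<xⱼ , λ i i<j → max (suc i) (s≤s i<j)

module _ {c y k xs} (k≤n : k ≤ length xs) (c<y : c < y) (before : ∀ {i} → i < k → at xs i < y) where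

  private
    ys = insertAt k y xs

  isLTRMaxAbove-insertAt⁺ : ∀ {j} → IsLTRMaxAbove y xs j → k ≤ j × IsLTRMaxAbove c ys (suc j)
  isLTRMaxAbove-insertAt⁺ {j} (j<n , y<xⱼ , max) =
    k≤j , subst (suc j <_) (sym (length-insertAt y xs k≤n)) (s≤s j<n) , c<yⱼ₊₁ , max′
    where
    k≤j : k ≤ j
    k≤j = ≮⇒≥ (<-asym y<xⱼ ∘ before)
    shifted : at ys (suc j) ≡ at xs j
    shifted = at-insertAt-≥ y xs k≤j
    c<yⱼ₊₁ : c < at ys (suc j)
    c<yⱼ₊₁ rewrite shifted = <-trans c<y y<xⱼ
    max′ : ∀ i → i < suc j → at ys i < at ys (suc j)
    max′ i i<j+1 rewrite shifted with <-cmp i k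
    ... | tri< i<k _ _ rewrite at-insertAt-< y xs k≤n i<k = <-trans (before i<k) y<xⱼ
    ... | tri≈ _ refl _ rewrite at-insertAt-≡ y xs k≤n = y<xⱼ
    max′ (suc i) (s≤s i<j) | tri> _ _ (s≤s k≤i) rewrite at-insertAt-≥ y xs k≤i = max i i<j

  isLTRMaxAbove-insertAt⁻ : ∀ {j} → k ≤ j → IsLTRMaxAbove c ys (suc j) → IsLTRMaxAbove y xs j
  isLTRMaxAbove-insertAt⁻ {j} k≤j (j+1<n , _ , max) =
    s<s⁻¹ (subst (suc j <_) (length-insertAt y xs k≤n) j+1<n) , y<xⱼ , max′
    where
    shifted : at ys (suc j) ≡ at xs j
    shifted = at-insertAt-≥ y xs k≤j
    y<xⱼ : y < at xs j
    y<xⱼ = subst₂ _<_ (at-insertAt-≡ y xs k≤n) shifted (max k (s≤s k≤j))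
    max′ : ∀ i → i < j → at xs i < at xs j
    max′ i i<j with i <? k
    ... | yes i<k = subst₂ _<_ (at-insertAt-< y xs k≤n i<k) shifted (max i (m≤n⇒m≤1+n i<j))
    ... | no  i≮k = subst₂ _<_ (at-insertAt-≥ y xs (≮⇒≥ i≮k)) shifted (max (suc i) (s≤s i<j))

Distinct : List ℕ → Set
Distinct xs = ∀ {i j} → i < length xs → j < length xs → at xs i ≡ at xs j → i ≡ j

-- The position that entry i of xs occupies in insertAt k y xs.
skip : ℕ → ℕ → ℕ
skip zero    i       = suc i
skip (suc k) zero    = zero
skip (suc k) (suc i) = suc (skip k i)

skip-injective : ∀ k {i j} → skip k i ≡ skip k j → i ≡ j
skip-injective zero                    refl = refl
skip-injective (suc k) {zero}  {zero}  _    = refl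
skip-injective (suc k) {suc i} {suc j} e = cong suc (skip-injective k (suc-injective e))

skip-< : ∀ k {i n} → i < n → skip k i < suc n
skip-< zero            i<n       = s≤s i<n
skip-< (suc k) {zero}  (s≤s _)   = z<s
skip-< (suc k) {suc i} (s≤s i<n) = s≤s (skip-< k i<n)

at-insertAt-skip : ∀ k y xs {i} → i < length xs → at (insertAt k y xs) (skip k i) ≡ at xs i
at-insertAt-skip zero    y xs               _         = refl
at-insertAt-skip (suc k) y (x ∷ xs) {zero}  _         = refl
at-insertAt-skip (suc k) y (x ∷ xs) {suc i} (s≤s i<n) = at-insertAt-skip k y xs i<n

distinct-insertAt : ∀ {k} y xs → k ≤ length xs → Distinct (insertAt k y xs) → Distinct xs
distinct-insertAt {k} y xs k≤n distinct {i} {j} i<n j<n xᵢ≡xⱼ =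
  skip-injective k (distinct (inside i<n) (inside j<n) (begin
    at (insertAt k y xs) (skip k i) ≡⟨ at-insertAt-skip k y xs i<n ⟩
    at xs i                         ≡⟨ xᵢ≡xⱼ ⟩
    at xs j                         ≡⟨ at-insertAt-skip k y xs j<n ⟨
    at (insertAt k y xs) (skip k j) ∎))
  where
  open ≡-Reasoning
  inside : ∀ {l} → l < length xs → skip k l < length (insertAt k y xs)
  inside l<n = subst (_ <_) (sym (length-insertAt y xs k≤n)) (skip-< k l<n)

distinct-tail : ∀ {y xs} → Distinct (y ∷ xs) → Distinct xs
distinct-tail {y} {xs} = distinct-insertAt y xs z≤n

upTo-suc : ∀ {P : ℕ → Set} {j} → (∀ {i} → i < j → P i) → P j → ∀ {i} → i < suc j → P i
upTo-suc below at-j (s≤s i≤j) with m≤n⇒m<n∨m≡n i≤j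
... | inj₁ i<j  = below i<j
... | inj₂ refl = at-j

prefixMax : ∀ xs {j} → j < length xs → ∃ λ m → m ≤ j × IsLTRMax xs m × (∀ {i} → i < suc j → at xs i ≤ at xs m)
prefixMax xs {zero} 0<n = 0 , z≤n , (0<n , λ _ ()) , λ { (s≤s z≤n) → ≤-refl }
prefixMax xs {suc j} j+1<n with prefixMax xs (<-trans (n<1+n j) j+1<n)
... | m , m≤j , maxₘ , bound with at xs m <? at xs (suc j)
...   | yes xₘ<xⱼ₊₁ =
  suc j , ≤-refl , (j+1<n , λ i i<j+1 → ≤-<-trans (bound i<j+1) xₘ<xⱼ₊₁) ,
  upTo-suc (λ i<j+1 → ≤-trans (bound i<j+1) (<⇒≤ xₘ<xⱼ₊₁)) ≤-refl
...   | no  xₘ≮xⱼ₊₁ = m , m≤n⇒m≤1+n m≤j , maxₘ , upTo-suc bound (≮⇒≥ xₘ≮xⱼ₊₁)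

dominated-by-ltrMax : ∀ xs {j} → Distinct xs → suc j < length xs → ¬ IsLTRMax xs (suc j) →
                      ∃ λ i → i < suc j × IsLTRMax xs i × at xs (suc j) < at xs i
dominated-by-ltrMax xs {j} distinct j+1<n ¬max with prefixMax xs (<-trans (n<1+n j) j+1<n)
... | m , m≤j , maxₘ , bound with <-cmp (at xs (suc j)) (at xs m)
...   | tri< xⱼ₊₁<xₘ _ _ = m , s≤s m≤j , maxₘ , xⱼ₊₁<xₘ
...   | tri≈ _ xⱼ₊₁≡xₘ _ = contradiction (distinct j+1<n (proj₁ maxₘ) xⱼ₊₁≡xₘ) (<⇒≢ (s≤s m≤j) ∘ sym)
...   | tri> _ _ xₘ<xⱼ₊₁ = contradiction (j+1<n , λ i i<j+1 → ≤-<-trans (bound i<j+1) xₘ<xⱼ₊₁) ¬max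

ltrMax-descent : ∀ xs {j} → Distinct xs → IsLTRMax xs j → suc j < length xs → ¬ IsLTRMax xs (suc j) →
                 at xs (suc j) < at xs j
ltrMax-descent xs {j} distinct (j<n , max) j+1<n ¬max with <-cmp (at xs (suc j)) (at xs j)
... | tri< xⱼ₊₁<xⱼ _ _ = xⱼ₊₁<xⱼ
... | tri≈ _ xⱼ₊₁≡xⱼ _ = contradiction (distinct j+1<n j<n xⱼ₊₁≡xⱼ) (<⇒≢ (n<1+n j) ∘ sym)
... | tri> _ _ xⱼ<xⱼ₊₁ = contradiction (j+1<n , λ i → upTo-suc (λ i<j → <-trans (max _ i<j) xⱼ<xⱼ₊₁) xⱼ<xⱼ₊₁) ¬max

-- Relabelling values commutes with queuesort

module Relabelling (f : ℕ → ℕ) where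

  -- Queuesort compares each entry only with the left-to-right maxima before it,
  -- so a relabelling is harmless as long as every maximum it destroys is isolated
  -- and followed by a descent, and every maximum it creates is dominated by an
  -- earlier one.
  record Compatible (c c′ : ℕ) (xs : List ℕ) : Set where
    field
      distinct : Distinct xs
      lost     : ∀ {j} → IsLTRMaxAbove c xs j → ¬ IsLTRMaxAbove c′ (map f xs) j →
                 suc j < length xs × at xs (suc j) < at xs j × (∀ {i} → j ≡ suc i → ¬ IsLTRMaxAbove c xs i)
      gained   : ∀ {j} → IsLTRMaxAbove c′ (map f xs) j → ¬ IsLTRMaxAbove c xs j →
                 ∃ λ i → i < j × IsLTRMaxAbove c xs i × at xs j < at xs i

  compatible-tail : ∀ {c c′ y xs} → ¬ c < y → Compatible c c′ (y ∷ xs) → ¬ c′ < f y × Compatible c c′ xs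
  compatible-tail {c} {c′} {y} {xs} c≮y comp = c′≮fy , record
    { distinct = distinct-tail distinct
    ; lost     = lost′
    ; gained   = gained′ }
    where
    open Compatible comp
    c′≮fy : ¬ c′ < f y
    c′≮fy c′<fy with gained (isLTRMaxAbove-head⁺ c′<fy) (c≮y ∘ isLTRMaxAbove-head⁻)
    ... | _ , () , _
    lost′ : ∀ {j} → IsLTRMaxAbove c xs j → ¬ IsLTRMaxAbove c′ (map f xs) j →
            suc j < length xs × at xs (suc j) < at xs j × (∀ {i} → j ≡ suc i → ¬ IsLTRMaxAbove c xs i)
    lost′ max ¬max′ with lost (isLTRMaxAbove-tail⁺ c≮y max) (¬max′ ∘ isLTRMaxAbove-tail⁻)
    ... | j+1<n , descent , isolated =
      s<s⁻¹ j+1<n , descent , λ { refl → isolated refl ∘ isLTRMaxAbove-tail⁺ c≮y }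
    gained′ : ∀ {j} → IsLTRMaxAbove c′ (map f xs) j → ¬ IsLTRMaxAbove c xs j →
              ∃ λ i → i < j × IsLTRMaxAbove c xs i × at xs j < at xs i
    gained′ max′ ¬max with gained (isLTRMaxAbove-tail⁺ c′≮fy max′) (¬max ∘ isLTRMaxAbove-tail⁻)
    ... | zero  , _         , max₀ , _  = contradiction (isLTRMaxAbove-head⁻ max₀) c≮y
    ... | suc i , s≤s i<j , maxᵢ , xⱼ<xᵢ = i , i<j , isLTRMaxAbove-tail⁻ maxᵢ , xⱼ<xᵢ

  module PushStep {c c′ y k xs} (stops : StopsAt y xs k) (c<y : c < y)
                  (comp : Compatible c c′ (insertAt k y xs)) where

    open StopsAt stops
    open Compatible comp

    private
      ys  = insertAt k y xs
      ys′ = insertAt k (f y) (map f xs)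

      relabelled : ∀ {c₀ j} → IsLTRMaxAbove c₀ (map f ys) j → IsLTRMaxAbove c₀ ys′ j
      relabelled = subst (λ zs → IsLTRMaxAbove _ zs _) (map-insertAt f k y xs)

      unrelabelled : ∀ {c₀ j} → IsLTRMaxAbove c₀ ys′ j → IsLTRMaxAbove c₀ (map f ys) j
      unrelabelled = subst (λ zs → IsLTRMaxAbove _ zs _) (sym (map-insertAt f k y xs))

      k<length : k < length ys
      k<length = subst (k <_) (sym (length-insertAt y xs k≤length)) (s≤s k≤length)

      k≤length′ : k ≤ length (map f xs)
      k≤length′ = subst (k ≤_) (sym (length-map f xs)) k≤length

      fy-at-k : at ys′ k ≡ f y
      fy-at-k = at-insertAt-≡ (f y) (map f xs) k≤length′

    y<xₖ : k < length xs → y < at xs k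
    y<xₖ k<n with <-cmp y (at xs k)
    ... | tri< y<xₖ _ _ = y<xₖ
    ... | tri> _ _ y>xₖ = contradiction y>xₖ (blocked k<n)
    ... | tri≈ _ y≡xₖ _ = contradiction k≡k+1 (<⇒≢ (n<1+n k))
      where
      k≡k+1 : k ≡ suc k
      k≡k+1 = distinct k<length (subst (suc k <_) (sym (length-insertAt y xs k≤length)) (s≤s k<n))
                (trans (at-insertAt-≡ y xs k≤length) (trans y≡xₖ (sym (at-insertAt-≥ y xs ≤-refl))))

    max-xₖ : k < length xs → IsLTRMaxAbove y xs k
    max-xₖ k<n = k<n , y<xₖ k<n , λ i i<k → <-trans (before i<k) (y<xₖ k<n)

    max-y : IsLTRMaxAbove c ys k
    max-y = k<length , subst (c <_) (sym (at-insertAt-≡ y xs k≤length)) c<y ,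
            λ i i<k → subst₂ _<_ (sym (at-insertAt-< y xs k≤length i<k)) (sym (at-insertAt-≡ y xs k≤length)) (before i<k)

    entry≤y : ∀ {i} → i ≤ k → at ys i ≤ y
    entry≤y i≤k with m≤n⇒m<n∨m≡n i≤k
    ... | inj₁ i<k  = <⇒≤ (subst (_< y) (sym (at-insertAt-< y xs k≤length i<k)) (before i<k))
    ... | inj₂ refl = ≤-reflexive (at-insertAt-≡ y xs k≤length)

    -- Relabelling keeps y and the entry blocking it as maxima: losing y would need
    -- a descent right after it, losing xₖ would need a non-maximum right before it.
    max-fy : IsLTRMaxAbove c′ ys′ k
    max-fy = decidable-stable (isLTRMaxAbove? c′ ys′ k) ¬¬max
      where
      ¬¬max : ¬ ¬ IsLTRMaxAbove c′ ys′ k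
      ¬¬max ¬max with lost max-y (¬max ∘ relabelled)
      ... | k+1<n , xₖ<y , _ =
        <-asym (y<xₖ (s<s⁻¹ (subst (suc k <_) (length-insertAt y xs k≤length) k+1<n)))
               (subst₂ _<_ (at-insertAt-≥ y xs ≤-refl) (at-insertAt-≡ y xs k≤length) xₖ<y)

    max-fxₖ : k < length xs → IsLTRMaxAbove c′ ys′ (suc k)
    max-fxₖ k<n = decidable-stable (isLTRMaxAbove? c′ ys′ (suc k)) ¬¬max
      where
      ¬¬max : ¬ ¬ IsLTRMaxAbove c′ ys′ (suc k)
      ¬¬max ¬max with lost (proj₂ (isLTRMaxAbove-insertAt⁺ k≤length c<y before (max-xₖ k<n))) (¬max ∘ relabelled)
      ... | _ , _ , isolated = isolated refl max-y

    c′<fy : c′ < f y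
    c′<fy = subst (c′ <_) fy-at-k (proj₁ (proj₂ max-fy))

    stops′ : StopsAt (f y) (map f xs) k
    stops′ = record
      { k≤length = k≤length′
      ; before   = λ i<k → subst₂ _<_ (at-insertAt-< (f y) (map f xs) k≤length′ i<k) fy-at-k (proj₂ (proj₂ max-fy) _ i<k)
      ; blocked  = λ k<n′ fxₖ<fy → <-asym fxₖ<fy
          (subst₂ _<_ fy-at-k (at-insertAt-≥ (f y) (map f xs) ≤-refl)
            (proj₂ (proj₂ (max-fxₖ (subst (k <_) (length-map f xs) k<n′))) k ≤-refl)) }

    private
      shift⁺ : ∀ {j} → IsLTRMaxAbove y xs j → k ≤ j × IsLTRMaxAbove c ys (suc j)
      shift⁺ = isLTRMaxAbove-insertAt⁺ k≤length c<y before

      shift⁻ : ∀ {j} → k ≤ j → IsLTRMaxAbove c ys (suc j) → IsLTRMaxAbove y xs j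
      shift⁻ = isLTRMaxAbove-insertAt⁻ k≤length c<y before

      shift′⁺ : ∀ {j} → IsLTRMaxAbove (f y) (map f xs) j → k ≤ j × IsLTRMaxAbove c′ ys′ (suc j)
      shift′⁺ = isLTRMaxAbove-insertAt⁺ k≤length′ c′<fy (StopsAt.before stops′)

      shift′⁻ : ∀ {j} → k ≤ j → IsLTRMaxAbove c′ ys′ (suc j) → IsLTRMaxAbove (f y) (map f xs) j
      shift′⁻ = isLTRMaxAbove-insertAt⁻ k≤length′ c′<fy (StopsAt.before stops′)

    lost′ : ∀ {j} → IsLTRMaxAbove y xs j → ¬ IsLTRMaxAbove (f y) (map f xs) j →
            suc j < length xs × at xs (suc j) < at xs j × (∀ {i} → j ≡ suc i → ¬ IsLTRMaxAbove y xs i)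
    lost′ max ¬max′ with shift⁺ max
    ... | k≤j , max-ys with lost max-ys (¬max′ ∘ shift′⁻ k≤j ∘ relabelled)
    ...   | j+2<n , descent , isolated =
      s<s⁻¹ (subst (suc (suc _) <_) (length-insertAt y xs k≤length) j+2<n) ,
      subst₂ _<_ (at-insertAt-≥ y xs (m≤n⇒m≤1+n k≤j)) (at-insertAt-≥ y xs k≤j) descent ,
      λ { refl → isolated refl ∘ proj₂ ∘ shift⁺ }

    -- A maximum of ys dominating xⱼ is either a shifted maximum of xs, or lies
    -- at or before y; in the latter case xⱼ < y, which forces j > k, and then
    -- the entry xₖ blocking y dominates xⱼ.
    dominated : ∀ {i j} → k ≤ j → j < length xs → i < suc j → IsLTRMaxAbove c ys i → at xs j < at ys i →
                ∃ λ i′ → i′ < j × IsLTRMaxAbove y xs i′ × at xs j < at xs i′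
    dominated {i} {j} k≤j j<n i<j+1 maxᵢ xⱼ<yᵢ with k <? i
    dominated {suc i} k≤j j<n (s≤s i<j) maxᵢ xⱼ<yᵢ | yes (s≤s k≤i) =
      i , i<j , shift⁻ k≤i maxᵢ , subst (_ <_) (at-insertAt-≥ y xs k≤i) xⱼ<yᵢ
    ... | no k≮i with m≤n⇒m<n∨m≡n k≤j
    ...   | inj₁ k<j  = k , k<j , max-xₖ (<-trans k<j j<n) ,
                        <-≤-trans xⱼ<yᵢ (≤-trans (entry≤y (≮⇒≥ k≮i)) (<⇒≤ (y<xₖ (<-trans k<j j<n))))
    ...   | inj₂ refl = contradiction (<-≤-trans xⱼ<yᵢ (entry≤y (≮⇒≥ k≮i))) (<-asym (y<xₖ j<n))

    gained′ : ∀ {j} → IsLTRMaxAbove (f y) (map f xs) j → ¬ IsLTRMaxAbove y xs j →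
              ∃ λ i → i < j × IsLTRMaxAbove y xs i × at xs j < at xs i
    gained′ {j} max′ ¬max with shift′⁺ max′
    ... | k≤j , max-ys′ with gained (unrelabelled max-ys′) (¬max ∘ shift⁻ k≤j)
    ...   | i , i<j+1 , maxᵢ , xⱼ<yᵢ =
      dominated k≤j (subst (j <_) (length-map f xs) (proj₁ max′)) i<j+1 maxᵢ
                (subst (_< at ys i) (at-insertAt-≥ y xs k≤j) xⱼ<yᵢ)

    compatible : Compatible y (f y) xs
    compatible = record
      { distinct = distinct-insertAt y xs k≤length distinct
      ; lost     = lost′
      ; gained   = gained′ }

  queuesortFrom-map : ∀ ys {c c′ xs} → queuesortFrom c ys ≡ xs → Compatible c c′ xs →
                      queuesortFrom c′ (map f ys) ≡ map f xs
  queuesortFrom-map []       refl _ = refl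
  queuesortFrom-map (y ∷ ys) {c} {c′} refl comp with c <? y
  ... | no c≮y with compatible-tail c≮y (subst (Compatible c c′) (queuesortFrom-≮ ys c≮y) comp)
  ...   | c′≮fy , comp′ = begin
    queuesortFrom c′ (f y ∷ map f ys)  ≡⟨ queuesortFrom-≮ (map f ys) c′≮fy ⟩
    f y ∷ queuesortFrom c′ (map f ys)  ≡⟨ cong (f y ∷_) (queuesortFrom-map ys refl comp′) ⟩
    map f (y ∷ queuesortFrom c ys)     ≡⟨ cong (map f) (queuesortFrom-≮ ys c≮y) ⟨
    map f (queuesortFrom c (y ∷ ys))   ∎
    where open ≡-Reasoning
  queuesortFrom-map (y ∷ ys) {c} {c′} refl comp | yes c<y with stopsAt y (queuesortFrom y ys)
  ... | k , stops = begin
    queuesortFrom c′ (f y ∷ map f ys)          ≡⟨ queuesortFrom-< (map f ys) c′<fy ⟩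
    push (f y) (queuesortFrom (f y) (map f ys)) ≡⟨ cong (push (f y)) (queuesortFrom-map ys refl compatible) ⟩
    push (f y) (map f zs)                       ≡⟨ push-stopsAt stops′ ⟩
    insertAt k (f y) (map f zs)                 ≡⟨ map-insertAt f k y zs ⟨
    map f (insertAt k y zs)                     ≡⟨ cong (map f) inserted ⟨
    map f (queuesortFrom c (y ∷ ys))            ∎
    where
    open ≡-Reasoning
    zs = queuesortFrom y ys
    inserted : queuesortFrom c (y ∷ ys) ≡ insertAt k y zs
    inserted = trans (queuesortFrom-< ys c<y) (push-stopsAt stops)
    open PushStep stops c<y (subst (Compatible c c′) inserted comp)

injective⇒surjective : ∀ {n} {g : Fin n → Fin n} → Injective _≡_ _≡_ g → ∀ i → ∃ λ k → g k ≡ i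
injective⇒surjective {suc m} {g} g-injective i with any? (λ k → g k ≟ᶠ i)
... | yes hit  = hit
... | no  miss = contradiction (injective⇒≤ squeezed-injective) (<-irrefl refl)
  where
  squeezed : Fin (suc m) → Fin m
  squeezed k = punchOut {i = i} (miss ∘ (k ,_) ∘ sym)
  squeezed-injective : Injective _≡_ _≡_ squeezed
  squeezed-injective {k} {l} = g-injective ∘ punchOut-injective {i = i} (miss ∘ (k ,_) ∘ sym) (miss ∘ (l ,_) ∘ sym)

Occurs : ℕ → List ℕ → Set
Occurs v xs = ∃ λ i → i < length xs × at xs i ≡ v

any⇒occurs : ∀ {v} xs → Any (λ x → T (v ≡ᵇ x)) xs → Occurs v xs
any⇒occurs {v} (x ∷ xs) (here v≡x) = zero , z<s , sym (≡ᵇ⇒≡ v x v≡x)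
any⇒occurs     (x ∷ xs) (there p) with any⇒occurs xs p
... | i , i<n , xᵢ≡v = suc i , s≤s i<n , xᵢ≡v

occurs⇒any : ∀ {v} xs → Occurs v xs → Any (λ x → T (v ≡ᵇ x)) xs
occurs⇒any {v} (x ∷ xs) (zero  , _         , refl) = here (≡⇒≡ᵇ v v refl)
occurs⇒any     (x ∷ xs) (suc i , s≤s i<n , xᵢ≡v) = there (occurs⇒any xs (i , i<n , xᵢ≡v))

record Perm (n : ℕ) (xs : List ℕ) : Set where
  field
    length≡ : length xs ≡ n
    occurs  : ∀ {v} → 0 < v → v ≤ n → Occurs v xs

isPerm⇒perm : ∀ {n} xs → IsPerm n xs → Perm n xs
isPerm⇒perm {n} xs isPerm = record
  { length≡ = ≡ᵇ⇒≡ (length xs) n length≡ᵇn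
  ; occurs  = λ { {suc v} _ v<n → any⇒occurs xs (any⁻ _ xs
      (All.lookup (all⁺ _ _ allOccur) (∈-map⁺ suc (∈-upTo⁺ v<n)))) } }
  where
  length≡ᵇn = proj₁ (Equivalence.to T-∧ isPerm)
  allOccur  = proj₂ (Equivalence.to T-∧ isPerm)

perm⇒isPerm : ∀ {n xs} → Perm n xs → IsPerm n xs
perm⇒isPerm {n} {xs} perm = Equivalence.from T-∧
  (≡⇒≡ᵇ (length xs) n length≡ , all⁻ _ (All.tabulate occurring))
  where
  open Perm perm
  occurring : ∀ {v} → v ∈ map suc (upTo n) → T (any (v ≡ᵇ_) xs)
  occurring v∈ with ∈-map⁻ suc v∈
  ... | u , u∈ , refl = any⁺ _ (occurs⇒any xs (occurs z<s (∈-upTo⁻ u∈)))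

-- Each value 1, …, n has a position, distinct values have distinct positions,
-- so by counting every position is taken by exactly one value.
module _ {n xs} (perm : Perm n xs) where

  open Perm perm

  private
    occurrence : (v : Fin n) → Occurs (suc (toℕ v)) xs
    occurrence v = occurs z<s (toℕ<n v)

    position : Fin n → Fin n
    position v = fromℕ< (subst (proj₁ (occurrence v) <_) length≡ (proj₁ (proj₂ (occurrence v))))

    at-position : ∀ v → at xs (toℕ (position v)) ≡ suc (toℕ v)
    at-position v = trans (cong (at xs) (toℕ-fromℕ< _)) (proj₂ (proj₂ (occurrence v)))

    position-injective : Injective _≡_ _≡_ position
    position-injective {v} {w} e = toℕ-injective (suc-injective (begin
      suc (toℕ v)                ≡⟨ at-position v ⟨
      at xs (toℕ (position v))   ≡⟨ cong (at xs ∘ toℕ) e ⟩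
      at xs (toℕ (position w))   ≡⟨ at-position w ⟩
      suc (toℕ w)                ∎))
      where open ≡-Reasoning

    valueAt : ∀ {i} → i < length xs → ∃ λ v → toℕ (position v) ≡ i
    valueAt {i} i<n with injective⇒surjective position-injective (fromℕ< (subst (i <_) length≡ i<n))
    ... | v , e = v , trans (cong toℕ e) (toℕ-fromℕ< _)

  perm-entry-range : ∀ {i} → i < length xs → 0 < at xs i × at xs i ≤ n
  perm-entry-range i<n with valueAt i<n
  ... | v , refl = subst (0 <_) (sym (at-position v)) z<s , subst (_≤ n) (sym (at-position v)) (toℕ<n v)

  perm-distinct : Distinct xs
  perm-distinct i<n j<n xᵢ≡xⱼ with valueAt i<n | valueAt j<n
  ... | v , refl | w , refl =
    cong (toℕ ∘ position) (toℕ-injective (suc-injective (trans (sym (at-position v)) (trans xᵢ≡xⱼ (at-position w)))))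

indexOf : ℕ → List ℕ → ℕ
indexOf v []       = 0
indexOf v (x ∷ xs) = if v ≡ᵇ x then 0 else suc (indexOf v xs)

indexOf-occurs : ∀ {v} xs → Occurs v xs → indexOf v xs < length xs × at xs (indexOf v xs) ≡ v
indexOf-occurs {v} (x ∷ xs) occ with v ≟ x
... | yes refl rewrite ≡ᵇ-refl v = z<s , refl
... | no  v≢x rewrite ≡ᵇ-false v≢x with occ
...   | zero  , _         , x≡v  = contradiction (sym x≡v) v≢x
...   | suc i , s≤s i<n , xᵢ≡v with indexOf-occurs xs (i , i<n , xᵢ≡v)
...     | index<n , at-index = s≤s index<n , at-index

indexOf-at : ∀ {xs} → Distinct xs → ∀ {i} → i < length xs → indexOf (at xs i) xs ≡ i
indexOf-at {xs} distinct {i} i<n with indexOf-occurs xs (i , i<n , refl)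
... | index<n , at-index = distinct index<n i<n at-index

at-extensional : ∀ {xs ys} → length xs ≡ length ys → (∀ {i} → i < length xs → at xs i ≡ at ys i) → xs ≡ ys
at-extensional {[]}     {[]}     _ _ = refl
at-extensional {x ∷ xs} {y ∷ ys} e same =
  cong₂ _∷_ (same z<s) (at-extensional (suc-injective e) (same ∘ s≤s))

All-at : ∀ {P : ℕ → Set} {xs} → (∀ {i} → i < length xs → P (at xs i)) → All P xs
All-at {xs = []}     _   = []
All-at {xs = x ∷ xs} pxs = pxs z<s ∷ All-at (pxs ∘ s≤s)

transfer : List ℕ → List ℕ → ℕ → ℕ
transfer π ρ v = at ρ (indexOf v π)

module _ {n π ρ} (permπ : Perm n π) (permρ : Perm n ρ) where

  private
    length≡ : length π ≡ length ρ
    length≡ = trans (Perm.length≡ permπ) (sym (Perm.length≡ permρ))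

  transfer-at : ∀ {i} → i < length π → transfer π ρ (at π i) ≡ at ρ i
  transfer-at i<n = cong (at ρ) (indexOf-at {π} (perm-distinct permπ) i<n)

  map-transfer : map (transfer π ρ) π ≡ ρ
  map-transfer = at-extensional (trans (length-map _ π) length≡) λ i<n →
    let i<n′ = subst (_ <_) (length-map _ π) i<n in
    trans (at-map _ π i<n′) (transfer-at i<n′)

  transfer-involutive : ∀ {v} → 0 < v → v ≤ n → transfer ρ π (transfer π ρ v) ≡ v
  transfer-involutive 0<v v≤n with Perm.occurs permπ 0<v v≤n
  ... | i , i<n , refl = trans (cong (transfer ρ π) (transfer-at i<n))
                               (cong (at π) (indexOf-at {ρ} (perm-distinct permρ) (subst (_ <_) length≡ i<n)))

  perm-map-transfer : ∀ {σ} → Perm n σ → Perm n (map (transfer π ρ) σ)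
  perm-map-transfer {σ} permσ = record
    { length≡ = trans (length-map _ σ) (Perm.length≡ permσ)
    ; occurs  = occurs′ }
    where
    occurs′ : ∀ {v} → 0 < v → v ≤ n → Occurs v (map (transfer π ρ) σ)
    occurs′ 0<v v≤n with Perm.occurs permρ 0<v v≤n
    ... | i , i<n , refl with perm-entry-range permπ (subst (_ <_) (sym length≡) i<n)
    ...   | 0<πᵢ , πᵢ≤n with Perm.occurs permσ 0<πᵢ πᵢ≤n
    ...     | j , j<n , σⱼ≡πᵢ = j , subst (j <_) (sym (length-map _ σ)) j<n ,
      trans (at-map _ σ j<n) (trans (cong (transfer π ρ) σⱼ≡πᵢ) (transfer-at (subst (_ <_) (sym length≡) i<n)))

  map-transfer-involutive : ∀ {σ} → Perm n σ → map (transfer ρ π) (map (transfer π ρ) σ) ≡ σ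
  map-transfer-involutive {σ} permσ = trans (sym (map-∘ σ)) (map-id-local (All-at λ i<n →
    let 0<σᵢ , σᵢ≤n = perm-entry-range permσ i<n in transfer-involutive 0<σᵢ σᵢ≤n))

preimage-≡ : ∀ {n π} {a b : Preimage n π} → proj₁ a ≡ proj₁ b → a ≡ b
preimage-≡ {a = σ , isPerm , qσ≡π} {b = .σ , isPerm′ , qσ≡π′} refl
  rewrite T-irrelevant isPerm isPerm′ | Decidable⇒UIP.≡-irrelevant (≡-dec _≟_) qσ≡π qσ≡π′ = refl

record LTRCompatible (π ρ : List ℕ) : Set where
  field
    lost   : ∀ {j} → IsLTRMax π j → ¬ IsLTRMax ρ j →
             suc j < length π × at π (suc j) < at π j × (∀ {i} → j ≡ suc i → ¬ IsLTRMax π i)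
    gained : ∀ {j} → IsLTRMax ρ j → ¬ IsLTRMax π j →
             ∃ λ i → i < j × IsLTRMax π i × at π j < at π i

module _ {n π ρ} (permπ : Perm n π) (permρ : Perm n ρ) where

  private
    above⁺ : ∀ {xs} → Perm n xs → ∀ {j} → IsLTRMax xs j → IsLTRMaxAbove 0 xs j
    above⁺ perm (j<n , max) = j<n , proj₁ (perm-entry-range perm j<n) , max

    above⁻ : ∀ {c} xs {j} → IsLTRMaxAbove c xs j → IsLTRMax xs j
    above⁻ xs (j<n , _ , max) = j<n , max

    inρ : ∀ {j} → IsLTRMaxAbove 0 (map (transfer π ρ) π) j → IsLTRMax ρ j
    inρ = above⁻ ρ ∘ subst (λ xs → IsLTRMaxAbove 0 xs _) (map-transfer permπ permρ)

    fromρ : ∀ {j} → IsLTRMax ρ j → IsLTRMaxAbove 0 (map (transfer π ρ) π) j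
    fromρ = subst (λ xs → IsLTRMaxAbove 0 xs _) (sym (map-transfer permπ permρ)) ∘ above⁺ permρ

  compatible-transfer : LTRCompatible π ρ → Relabelling.Compatible (transfer π ρ) 0 0 π
  compatible-transfer compatible = record
    { distinct = perm-distinct permπ
    ; lost     = λ max ¬maxρ → case-lost (lost (above⁻ π max) (¬maxρ ∘ fromρ))
    ; gained   = λ maxρ ¬max → case-gained (gained (inρ maxρ) (¬max ∘ above⁺ permπ)) }
    where
    open LTRCompatible compatible
    case-lost : ∀ {j} → suc j < length π × at π (suc j) < at π j × (∀ {i} → j ≡ suc i → ¬ IsLTRMax π i) →
                suc j < length π × at π (suc j) < at π j × (∀ {i} → j ≡ suc i → ¬ IsLTRMaxAbove 0 π i)
    case-lost (j+1<n , descent , isolated) = j+1<n , descent , λ e → isolated e ∘ above⁻ π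
    case-gained : ∀ {j} → (∃ λ i → i < j × IsLTRMax π i × at π j < at π i) →
                  ∃ λ i → i < j × IsLTRMaxAbove 0 π i × at π j < at π i
    case-gained (i , i<j , maxᵢ , xⱼ<xᵢ) = i , i<j , above⁺ permπ maxᵢ , xⱼ<xᵢ

  relabel : LTRCompatible π ρ → Preimage n π → Preimage n ρ
  relabel compatible (σ , isPermσ , qσ≡π) =
    map (transfer π ρ) σ ,
    perm⇒isPerm (perm-map-transfer permπ permρ (isPerm⇒perm σ isPermσ)) ,
    trans (Relabelling.queuesortFrom-map (transfer π ρ) σ qσ≡π (compatible-transfer compatible))
          (map-transfer permπ permρ)

preimages-↔ : ∀ {n π ρ} → Perm n π → Perm n ρ → LTRCompatible π ρ → LTRCompatible ρ π →
              Preimage n π ↔ Preimage n ρ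
preimages-↔ permπ permρ πρ ρπ = mk↔ₛ′ (relabel permπ permρ πρ) (relabel permρ permπ ρπ)
  (λ (σ , isPermσ , _) → preimage-≡ (map-transfer-involutive permρ permπ (isPerm⇒perm σ isPermσ)))
  (λ (σ , isPermσ , _) → preimage-≡ (map-transfer-involutive permπ permρ (isPerm⇒perm σ isPermσ)))

proposition4p6 : (n : ℕ) (π ρ : List ℕ) → IsPerm n π → IsPerm n ρ → (p : ℕ)
    → IsLTRMax π (suc p) → ¬ IsLTRMax π p → suc (suc p) < length π → ¬ IsLTRMax π (suc (suc p))
    → (∀ j → IsLTRMax ρ j ⇔ (IsLTRMax π j × j ≢ suc p))
    → Preimage n π ↔ Preimage n ρ
proposition4p6 n π ρ isPermπ isPermρ p _ ¬max-before p+2<n ¬max-after maxρ⇔ =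
  preimages-↔ permπ permρ forward backward
  where
  permπ = isPerm⇒perm π isPermπ
  permρ = isPerm⇒perm ρ isPermρ
  maxρ⇒maxπ : ∀ {j} → IsLTRMax ρ j → IsLTRMax π j
  maxρ⇒maxπ = proj₁ ∘ Equivalence.to (maxρ⇔ _)
  lost-is-μ : ∀ {j} → IsLTRMax π j → ¬ IsLTRMax ρ j → j ≡ suc p
  lost-is-μ {j} max ¬maxρ = decidable-stable (j ≟ suc p) (¬maxρ ∘ Equivalence.from (maxρ⇔ j) ∘ (max ,_))
  forward : LTRCompatible π ρ
  forward = record
    { lost   = λ max ¬maxρ → case lost-is-μ max ¬maxρ of λ { refl →
        p+2<n , ltrMax-descent π (perm-distinct permπ) max p+2<n ¬max-after , λ { refl → ¬max-before } }
    ; gained = λ maxρ ¬max → contradiction (maxρ⇒maxπ maxρ) ¬max }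
  backward : LTRCompatible ρ π
  backward = record
    { lost   = λ maxρ ¬max → contradiction (maxρ⇒maxπ maxρ) ¬max
    ; gained = λ max ¬maxρ → case lost-is-μ max ¬maxρ of λ { refl →
        dominated-by-ltrMax ρ (perm-distinct permρ) (subst (_ <_) length≡ (proj₁ max)) ¬maxρ } }
    where
    length≡ : length π ≡ length ρ
    length≡ = trans (Perm.length≡ permπ) (sym (Perm.length≡ permρ))
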